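{- Let $G$ be a finite abelian $p$-group with character group $G^*$. The number of long flags $S$ of $G^*$ with $\operatorname{disc}(S)=n$ is $O(n^{\#G})$ as $n\to\infty$.
   Context: $G^*$ is the group of homomorphisms $G\to S^1$. A long flag is a sequence $S=(S_n)_{n\ge0}$ of subgroups $S_n\subset G^*$ with $S_n\subset S_m$ whenever $n\le m$ and $S_n=G^*$ for all $n$ large enough. With the convention $S_{ -1}=\emptyset$, define $\operatorname{disc}(S):=\sum_{n\ge1}n\,(\#S_n-\#S_{n-1})$. -}

module Defs where

open import Level using (Level; _⊔_)
open import Algebra.Bundles using (AbelianGroup)
import Algebra.Definitions.RawMonoid as RawMonoidDefs
open import Data.Nat using (ℕ; zero; suc; _+_; _*_; _∸_; _^_; _≤_)
open import Data.Bool using (Bool; true)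
open import Data.List using (List; length; filterᵇ)
open import Data.List.Relation.Unary.Any using (Any)
open import Data.List.Relation.Unary.AllPairs using (AllPairs)
open import Data.Product using (∃; Σ; proj₁)
open import Relation.Binary.PropositionalEquality using (_≡_)
open import Relation.Nullary using (¬_)

record FiniteGroup {c ℓ : Level} (H : AbelianGroup c ℓ) : Set (c ⊔ ℓ) where
  open AbelianGroup H
  field
    elems    : List Carrier
    complete : ∀ x → Any (x ≈_) elems
    distinct : AllPairs (λ a b → ¬ (a ≈ b)) elems

  order : ℕ
  order = length elems

IsPGroup : {c ℓ : Level} → ℕ → AbelianGroup c ℓ → Set (c ⊔ ℓ)
IsPGroup p H = ∀ x → ∃ λ k → (p ^ k) × x ≈ ε
  where
  open AbelianGroup H
  open RawMonoidDefs rawMonoid using (_×_)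

module _ {c ℓ : Level} (H : AbelianGroup c ℓ) (fin : FiniteGroup H) where
  open AbelianGroup H
  open FiniteGroup fin

  Subset : Set c
  Subset = Carrier → Bool

  record IsSubgroup (S : Subset) : Set (c ⊔ ℓ) where
    field
      respects : ∀ {x y} → x ≈ y → S x ≡ S y
      has-ε    : S ε ≡ true
      ∙-closed : ∀ {x y} → S x ≡ true → S y ≡ true → S (x ∙ y) ≡ true
      ⁻¹-closed : ∀ {x} → S x ≡ true → S (x ⁻¹) ≡ true

  card : Subset → ℕ
  card S = length (filterᵇ S elems)

  record LongFlag : Set (c ⊔ ℓ) where
    field
      S         : ℕ → Subset
      subgroup  : ∀ n → IsSubgroup (S n)
      monotone  : ∀ {n m} → n ≤ m → ∀ x → S n x ≡ true → S m x ≡ true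
      eventually : Σ ℕ λ N → ∀ m → N ≤ m → ∀ x → S m x ≡ true

  open LongFlag

  -- Σ_{n=1}^{N} n (#S_n - #S_{n-1})  (the n = 0 term, involving S_{-1} = ∅,
  -- is multiplied by 0 and omitted). Differences are nonnegative by monotonicity.
  discUpTo : (ℕ → Subset) → ℕ → ℕ
  discUpTo T zero    = 0
  discUpTo T (suc N) = discUpTo T N + suc N * (card (T (suc N)) ∸ card (T N))

  -- disc(S): all terms beyond the stabilisation index vanish.
  disc : LongFlag → ℕ
  disc F = discUpTo (S F) (proj₁ (eventually F))

  Distinct : LongFlag → LongFlag → Set c
  Distinct F G = ¬ (∀ n x → S F n x ≡ S G n x)

{-# OPTIONS --safe #-}
-- A long flag S is determined by the entry times t(x) = min {m | x ∈ S_m} of the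
-- elements x of G*. If x ∉ S_m, then x enters at some k > m, where #S_k > #S_{k-1},
-- so the k-th term of disc(S) is already at least k > m. Hence disc(S) = n forces
-- t(x) ≤ n for all x, and there are at most (n + 1)^#G* = (n + 1)^#G long flags of
-- discriminant n.
module Submission where

open import Defs
open import Level using (Level)
open import Algebra.Bundles using (AbelianGroup)
open import Algebra.Properties.CommutativeSemigroup using (interchange)
open import Data.Bool using (Bool; true; false; if_then_else_)
open import Data.Fin as Fin using (Fin; zero; suc; funToFin; finToFun)
open import Data.Fin.Properties as Finₚ using (injective⇒≤; finToFun-funToFin)
open import Data.List using (List; []; _∷_; length; lookup; filterᵇ)
open import Data.List.Membership.Propositional.Properties using (∈-lookup)
open import Data.List.Relation.Unary.All as All using (All)
open import Data.List.Relation.Unary.Any as Any using (Any; here; there)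
open import Data.List.Relation.Unary.Any.Properties using (lookup-index)
open import Data.List.Relation.Unary.AllPairs using (AllPairs; _∷_)
open import Data.Nat
open import Data.Nat.Primality using (Prime)
open import Data.Nat.Properties
open import Data.Product using (∃; _×_; _,_; proj₂)
open import Function using (_∘_)
open import Function.Definitions using (Injective)
open import Relation.Binary.Definitions using (tri<; tri≈; tri>)
open import Relation.Binary.PropositionalEquality
open import Relation.Nullary using (yes; no; contradiction)

^-distribʳ-* : ∀ m n k → (m * n) ^ k ≡ m ^ k * n ^ k
^-distribʳ-* m n zero    = refl
^-distribʳ-* m n (suc k) = begin
  m * n * (m * n) ^ k       ≡⟨ cong (m * n *_) (^-distribʳ-* m n k) ⟩
  m * n * (m ^ k * n ^ k)   ≡⟨ interchange *-commutativeSemigroup m n (m ^ k) (n ^ k) ⟩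
  m * m ^ k * (n * n ^ k)   ∎
  where open ≡-Reasoning

funToFin-injective : ∀ {m n} {f g : Fin m → Fin n} → funToFin f ≡ funToFin g → ∀ i → f i ≡ g i
funToFin-injective {f = f} {g} eq i = begin
  f i                      ≡⟨ finToFun-funToFin f i ⟨
  finToFun (funToFin f) i  ≡⟨ cong (λ k → finToFun k i) eq ⟩
  finToFun (funToFin g) i  ≡⟨ finToFun-funToFin g i ⟩
  g i                      ∎
  where open ≡-Reasoning

Monotone : (ℕ → Bool) → Set
Monotone f = ∀ {i j} → i ≤ j → f i ≡ true → f j ≡ true

entryTime : (ℕ → Bool) → (n : ℕ) → Fin (suc n)
entryTime f zero    = zero
entryTime f (suc n) = if f 0 then zero else suc (entryTime (f ∘ suc) n)

entryTime-injective : ∀ {f g n} → Monotone f → Monotone g →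
                      entryTime f n ≡ entryTime g n → ∀ {m} → m < n → f m ≡ g m
entryTime-injective {f} {g} {suc n} f↑ g↑ eq {m} m<n with f 0 in f0 | g 0 in g0 | m
... | true  | true  | _     = trans (f↑ z≤n f0) (sym (g↑ z≤n g0))
... | false | false | zero  = trans f0 (sym g0)
... | false | false | suc m =
  entryTime-injective (f↑ ∘ s≤s) (g↑ ∘ s≤s) (Finₚ.suc-injective eq) (s<s⁻¹ m<n)

module _ {a} {A : Set a} where

  length-filterᵇ-⊆ : {p q : A → Bool} → (∀ x → p x ≡ true → q x ≡ true) →
                     ∀ xs → length (filterᵇ p xs) ≤ length (filterᵇ q xs)
  length-filterᵇ-⊆         p⊆q []       = z≤n
  length-filterᵇ-⊆ {p} {q} p⊆q (x ∷ xs) with p x in px | q x in qx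
  ... | true  | true  = s≤s (length-filterᵇ-⊆ p⊆q xs)
  ... | true  | false with () ← trans (sym (p⊆q x px)) qx
  ... | false | true  = m≤n⇒m≤1+n (length-filterᵇ-⊆ p⊆q xs)
  ... | false | false = length-filterᵇ-⊆ p⊆q xs

  length-filterᵇ-⊂ : {p q : A → Bool} → (∀ x → p x ≡ true → q x ≡ true) →
                     ∀ xs → Any (λ y → p y ≡ false × q y ≡ true) xs →
                     length (filterᵇ p xs) < length (filterᵇ q xs)
  length-filterᵇ-⊂ p⊆q (x ∷ xs) (here (px , qx)) rewrite px | qx =
    s≤s (length-filterᵇ-⊆ p⊆q xs)
  length-filterᵇ-⊂ {p} {q} p⊆q (x ∷ xs) (there new) with p x in px | q x in qx
  ... | true  | true  = s≤s (length-filterᵇ-⊂ p⊆q xs new)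
  ... | true  | false with () ← trans (sym (p⊆q x px)) qx
  ... | false | true  = m<n⇒m<1+n (length-filterᵇ-⊂ p⊆q xs new)
  ... | false | false = length-filterᵇ-⊂ p⊆q xs new

  AllPairs-lookup : ∀ {r} {R : A → A → Set r} {xs} → AllPairs R xs →
                    ∀ {i j} → i Fin.< j → R (lookup xs i) (lookup xs j)
  AllPairs-lookup (Rx ∷ _)   {zero}  {suc j} _         = All.lookup Rx (∈-lookup j)
  AllPairs-lookup (_  ∷ Rxs) {suc i} {suc j} (s<s i<j) = AllPairs-lookup Rxs i<j

  AllPairs-length-≤ : ∀ {p r} {P : A → Set p} {R : A → A → Set r} {M} (code : A → Fin M) →
                      (∀ {x y} → P x → P y → R x y → code x ≢ code y) →
                      ∀ {xs} → All P xs → AllPairs R xs → length xs ≤ M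
  AllPairs-length-≤ {P = P} code separates {xs} Pxs Rxs = injective⇒≤ code∘lookup-injective
    where
    P-lookup : ∀ i → P (lookup xs i)
    P-lookup i = All.lookup Pxs (∈-lookup i)

    code∘lookup-injective : Injective _≡_ _≡_ (code ∘ lookup xs)
    code∘lookup-injective {i} {j} eq with Finₚ.<-cmp i j
    ... | tri< i<j _ _ = contradiction eq (separates (P-lookup i) (P-lookup j) (AllPairs-lookup Rxs i<j))
    ... | tri≈ _ i≡j _ = i≡j
    ... | tri> _ _ j<i = contradiction (sym eq) (separates (P-lookup j) (P-lookup i) (AllPairs-lookup Rxs j<i))

module _ {c ℓ : Level} (H : AbelianGroup c ℓ) (fin : FiniteGroup H) where
  open AbelianGroup H using (Carrier; _≈_)
  open FiniteGroup fin
  open LongFlag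

  card-< : {T U : Subset H fin} →
           (∀ {x y} → x ≈ y → T x ≡ T y) → (∀ {x y} → x ≈ y → U x ≡ U y) →
           (∀ x → T x ≡ true → U x ≡ true) →
           ∀ {x} → T x ≡ false → U x ≡ true → card H fin T < card H fin U
  card-< T-resp U-resp T⊆U {x} Tx Ux = length-filterᵇ-⊂ T⊆U elems
    (Any.map (λ x≈y → trans (sym (T-resp x≈y)) Tx , trans (sym (U-resp x≈y)) Ux) (complete x))

  module _ (F : LongFlag H fin) where

    S-respects : ∀ m {x y} → x ≈ y → S F m x ≡ S F m y
    S-respects m = IsSubgroup.respects (subgroup F m)

    m<discUpTo : ∀ {m N x} → S F m x ≡ false → S F N x ≡ true → m < discUpTo H fin (S F) N
    m<discUpTo {m} {zero}  {x} x∉S[m] x∈S[0] with () ← trans (sym (monotone F z≤n x x∈S[0])) x∉S[m]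
    m<discUpTo {m} {suc N} {x} x∉S[m] x∈S[1+N] with S F N x in x∈?S[N]
    ... | true  = ≤-trans (m<discUpTo x∉S[m] x∈?S[N]) (m≤m+n _ _)
    ... | false = begin-strict
      m                    <⟨ s≤s m≤N ⟩
      suc N                ≡⟨ *-identityʳ (suc N) ⟨
      suc N * 1            ≤⟨ *-monoʳ-≤ (suc N) (m<n⇒0<n∸m (card-< (S-respects N) (S-respects (suc N))
                                                  (monotone F (n≤1+n N)) x∈?S[N] x∈S[1+N])) ⟩
      suc N * jump         ≤⟨ m≤n+m (suc N * jump) (discUpTo H fin (S F) N) ⟩
      discUpTo H fin (S F) (suc N) ∎
      where
      open ≤-Reasoning
      jump : ℕ
      jump = card H fin (S F (suc N)) ∸ card H fin (S F N)
      m≤N : m ≤ N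
      m≤N with m ≤? N
      ... | yes m≤N = m≤N
      ... | no  m≰N with () ← trans (sym (monotone F (≰⇒> m≰N) x x∈S[1+N])) x∉S[m]

    disc≤⇒full : ∀ {m} → disc H fin F ≤ m → ∀ x → S F m x ≡ true
    disc≤⇒full {m} disc≤m x with S F m x in x∈?S[m]
    ... | true  = refl
    ... | false = contradiction (m<discUpTo x∈?S[m] (proj₂ (eventually F) _ ≤-refl x)) (≤⇒≯ disc≤m)

  entryTimes : (n : ℕ) → LongFlag H fin → Fin order → Fin (suc n)
  entryTimes n F i = entryTime (λ m → S F m (lookup elems i)) n

  entryTimes-injective : ∀ {n} F G → disc H fin F ≤ n → disc H fin G ≤ n →
                         (∀ i → entryTimes n F i ≡ entryTimes n G i) →
                         ∀ m x → S F m x ≡ S G m x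
  entryTimes-injective {n} F G discF≤n discG≤n same m x = begin
    S F m x  ≡⟨ S-respects F m x≈y ⟩
    S F m y  ≡⟨ agree m ⟩
    S G m y  ≡⟨ S-respects G m x≈y ⟨
    S G m x  ∎
    where
    open ≡-Reasoning
    i : Fin order
    i = Any.index (complete x)
    y : Carrier
    y = lookup elems i
    x≈y : x ≈ y
    x≈y = lookup-index (complete x)
    agree : ∀ m → S F m y ≡ S G m y
    agree m with m <? n
    ... | yes m<n = entryTime-injective (λ i≤j → monotone F i≤j y) (λ i≤j → monotone G i≤j y)
                                        (same i) m<n
    ... | no  m≮n = trans (disc≤⇒full F (≤-trans discF≤n (≮⇒≥ m≮n)) y)
                      (sym (disc≤⇒full G (≤-trans discG≤n (≮⇒≥ m≮n)) y))

  distinctFlags-length-≤ : ∀ n {L} → All (λ F → disc H fin F ≤ n) L →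
                           AllPairs (Distinct H fin) L → length L ≤ suc n ^ order
  distinctFlags-length-≤ n = AllPairs-length-≤ (funToFin ∘ entryTimes n)
    (λ {F} {G} discF≤n discG≤n F≠G eq →
      F≠G (entryTimes-injective F G discF≤n discG≤n (funToFin-injective eq)))

lemma3p1p1p7 : {c ℓ : Level} (p : ℕ) → Prime p
    → (H : AbelianGroup c ℓ) (fin : FiniteGroup H) → IsPGroup p H
    → ∃ λ C → ∃ λ N₀ → ∀ n → N₀ ≤ n
    → (L : List (LongFlag H fin))
    → All (λ F → disc H fin F ≡ n) L
    → AllPairs (Distinct H fin) L
    → length L ≤ C * n ^ FiniteGroup.order fin
lemma3p1p1p7 _ _ H fin _ = 2 ^ order , 1 , bound
  where
  open FiniteGroup fin using (order)
  bound : ∀ n → 1 ≤ n → (L : List (LongFlag H fin)) → All (λ F → disc H fin F ≡ n) L →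
          AllPairs (Distinct H fin) L → length L ≤ 2 ^ order * n ^ order
  bound n 1≤n L discs distinct = begin
    length L               ≤⟨ distinctFlags-length-≤ H fin n (All.map ≤-reflexive discs) distinct ⟩
    suc n ^ order          ≤⟨ ^-monoˡ-≤ order 1+n≤2*n ⟩
    (2 * n) ^ order        ≡⟨ ^-distribʳ-* 2 n order ⟩
    2 ^ order * n ^ order  ∎
    where
    open ≤-Reasoning
    1+n≤2*n : suc n ≤ 2 * n
    1+n≤2*n = subst (suc n ≤_) (cong (n +_) (sym (+-identityʳ n))) (+-monoˡ-≤ n 1≤n)
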